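{- Let $G$ be a connected bipartite graph with bipartition $(X,Y)$, and let $n\geq 3$ be an integer. Let $\widetilde{G}_{n}$ be the graph with vertex set $\{(v,i): v\in V(G),\ i\in\{1,\dots,n\}\}$ (i.e. $\bigcup_{i=1}^n (X_i\cup Y_i)$ with $X_i=\{(x,i):x\in X\}$, $Y_i=\{(y,i):y\in Y\}$), in which, for every edge $xy\in E(G)$ with $x\in X$, $y\in Y$ and every $i\in\{1,\dots,n\}$, the vertices $(x,i)$ and $(y,i)$ are adjacent, and the vertices $(x,i+1)$ and $(y,i)$ are adjacent (indices taken modulo $n$, so $X_{n+1}=X_1$), and there are no other edges. Equivalently, $\widetilde{G}_n=\bigcup_{i=1}^n (H_i\cup H_i')$, where $H_i$ is a copy of $G$ with bipartition $(X_i,Y_i)$ and $H_i'$ is a copy of $G$ with bipartition $(X_{i+1},Y_i)$. If $|X|\geq\delta(G)+1$, $|Y|\geq\delta(G)+1$ and $\kappa(G)>\frac{2}{n}\delta(G)$, then $\widetilde{G}_{n}$ is super-$\kappa$.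
   Context: All graphs are simple. $\delta(G)$ is the minimum degree. For a non-complete graph $G$, the connectivity $\kappa(G)$ is the minimum size of a vertex set $S$ such that $G-S$ is disconnected; for a complete graph $\kappa(G)=|V(G)|-1$. A graph $G$ is super connected (super-$\kappa$) if every minimum vertex cut of $G$ is the neighborhood $N_G(v)$ of some vertex $v$ of minimum degree $\delta(G)$. -}

module Defs where

open import Data.Nat using (ℕ; zero; suc; _+_; _*_; _∸_; _≤_; _<_; _<?_; s≤s)
open import Data.Fin using (Fin; toℕ; fromℕ<; remQuot; _≟_)
open import Data.Fin.Subset using (Subset; ∣_∣)
open import Data.Vec using (tabulate; lookup; replicate)
open import Data.Bool using (Bool; true; false; _∧_; _∨_; not; if_then_else_)
open import Data.Product using (Σ; ∃; _×_; _,_)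
open import Data.Sum using (_⊎_)
open import Relation.Nullary using (¬_; yes; no)
open import Relation.Nullary.Decidable using (⌊_⌋)
open import Relation.Binary.PropositionalEquality using (_≡_; _≢_)

Adj : ℕ → Set
Adj m = Fin m → Fin m → Bool

IsSimple : ∀ {m} → Adj m → Set
IsSimple A = (∀ u v → A u v ≡ A v u) × (∀ v → A v v ≡ false)

Nbhd : ∀ {m} → Adj m → Fin m → Subset m
Nbhd A v = tabulate (A v)

deg : ∀ {m} → Adj m → Fin m → ℕ
deg A v = ∣ Nbhd A v ∣

IsMinDegree : ∀ {m} → Adj m → ℕ → Set
IsMinDegree A d = (∃ λ v → deg A v ≡ d) × (∀ v → d ≤ deg A v)

-- Walks in G - S (all vertices of the walk lie outside S).
data Reach {m} (A : Adj m) (S : Subset m) : Fin m → Fin m → Set where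
  here : ∀ {v} → lookup S v ≡ false → Reach A S v v
  step : ∀ {u w v} → lookup S u ≡ false → A u w ≡ true → Reach A S w v → Reach A S u v

emptySet : ∀ {m} → Subset m
emptySet = replicate _ false

Connected : ∀ {m} → Adj m → Set
Connected {m} A = ∀ (u v : Fin m) → Reach A emptySet u v

Complete : ∀ {m} → Adj m → Set
Complete A = ∀ u v → u ≢ v → A u v ≡ true

IsCut : ∀ {m} → Adj m → Subset m → Set
IsCut A S = ∃ λ u → ∃ λ v →
  lookup S u ≡ false × lookup S v ≡ false × ¬ Reach A S u v

IsConnectivity : ∀ {m} → Adj m → ℕ → Set
IsConnectivity {m} A k =
  (Complete A × k ≡ m ∸ 1)
  ⊎ (¬ Complete A × (∃ λ S → IsCut A S × ∣ S ∣ ≡ k) × (∀ S → IsCut A S → k ≤ ∣ S ∣))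

SuperKappa : ∀ {m} → Adj m → Set
SuperKappa A = ∀ k S → IsConnectivity A k → IsCut A S → ∣ S ∣ ≡ k →
  ∃ λ v → S ≡ Nbhd A v × (∀ w → deg A v ≤ deg A w)

-- Bipartition (X,Y) given by a colouring: col v = true means v ∈ X.
IsBipartition : ∀ {m} → Adj m → (Fin m → Bool) → Set
IsBipartition A col = ∀ u v → A u v ≡ true → col u ≢ col v

XSet YSet : ∀ {m} → (Fin m → Bool) → Subset m
XSet col = tabulate col
YSet col = tabulate (λ v → not (col v))

csuc : ∀ {n} → Fin n → Fin n
csuc {suc m} i with suc (toℕ i) <? suc m
... | yes p = fromℕ< p
... | no _  = Fin.zero

eqᵇ : ∀ {n} → Fin n → Fin n → Bool
eqᵇ i j = ⌊ i ≟ j ⌋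

-- G̃_n on vertex set Fin (m * n), vertex a ↔ (v , i) = remQuot n a.
-- (x,i) ~ (y,j) for xy ∈ E(G), x ∈ X, y ∈ Y iff i = j or i = j+1 (mod n).
tildeAdj : ∀ {m} (A : Adj m) (col : Fin m → Bool) (n : ℕ) → Adj (m * n)
tildeAdj {m} A col n a b with remQuot {m} n a | remQuot {m} n b
... | (u , i) | (v , j) =
  A u v ∧ (if col u
           then (not (col v) ∧ (eqᵇ i j ∨ eqᵇ i (csuc j)))
           else (col v ∧ (eqᵇ j i ∨ eqᵇ j (csuc i))))

module Submission where

-- Number the half-layers X₀, Y₀, X₁, Y₁, … of G̃ cyclically by positions s mod 2n; the edges
-- between positions s and s+1 form a copy of G. Let S be a minimum cut. Then |S| ≤ 2δ, the
-- degree bound in G̃, so the numbers z_s of deleted vertices at position s satisfy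
-- Σ (z_s + z_{s+1}) ≤ 4δ < 2nκ: some copy of G loses fewer than κ vertices and stays connected.
-- From there reachability spreads across every position with z_s < δ, because each survivor has δ
-- neighbours at both adjacent positions. At most two positions are heavy (z_s ≥ δ), and if there are
-- two then every other position is empty and gets reached through an intact copy of G or, if it is
-- the only position between the heavy ones, through its neighbours. Hence all non-isolated
-- survivors lie in one component, so one side of the cut is an isolated vertex x, and minimality
-- gives S = N(x).

open import Defs
open import Data.Bool using (Bool; true; false; _∧_; _∨_; not; if_then_else_)
import Data.Bool as Bool
open import Data.Bool.Properties using (not-involutive)
open import Data.Empty using (⊥; ⊥-elim)
open import Data.Fin as Fin using (Fin; toℕ; fromℕ<; combine; remQuot; _↑ˡ_; _↑ʳ_; _≟_)
open import Data.Fin.Properties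
  using (toℕ-fromℕ<; toℕ-injective; toℕ<n; remQuot-combine; combine-surjective; combine-injectiveʳ; any?)
import Data.Fin.Properties as Fin
open import Data.Fin.Subset using (Subset; ∣_∣)
open import Data.Nat using (ℕ; zero; suc; _+_; _*_; _∸_; _≤_; _<_; _≤?_; _<?_; _%_; ⌊_/2⌋; z≤n; s≤s)
open import Data.Nat.DivMod using (_mod_; m%n<n; m<n⇒m%n≡m; n%n≡0; %-distribˡ-+; m%n%n≡m%n; [m+n]%n≡m%n)
open import Data.Nat.Properties hiding (_≟_)
open import Algebra.Properties.CommutativeMonoid.Sum +-0-commutativeMonoid
  using (sum; sum-syntax; ∑-distrib-+; ∑-comm; sum-cong-≗)
open import Data.Product using (∃; _×_; _,_; proj₁; proj₂; map)
open import Data.Sum using (_⊎_; inj₁; inj₂) renaming (map to map⊎)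
open import Data.Vec using (lookup; tabulate)
open import Data.Vec.Properties using (lookup∘tabulate; tabulate∘lookup; tabulate-cong)
open import Function using (_∘_; id)
open import Relation.Nullary using (¬_; yes; no; Dec; contradiction)
open import Relation.Nullary.Decidable using (¬¬-excluded-middle; _×-dec_)
open import Relation.Nullary.Negation using (¬¬-map; Stable)
open import Relation.Binary.PropositionalEquality

∨-introˡ : ∀ {a b} → a ≡ true → a ∨ b ≡ true
∨-introˡ refl = refl

∨-introʳ : ∀ a {b} → b ≡ true → a ∨ b ≡ true
∨-introʳ true  _ = refl
∨-introʳ false b = b

∨-elim : ∀ a {b} → a ∨ b ≡ true → a ≡ true ⊎ b ≡ true
∨-elim true  _ = inj₁ refl
∨-elim false b = inj₂ b

∧-elimʳ : ∀ a {b} → a ∧ b ≡ true → b ≡ true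
∧-elimʳ true b = b

∧-true⇒false : ∀ {a b} → a ≡ true → a ∧ b ≡ false → b ≡ false
∧-true⇒false refl b = b

infix 5 _==_
_==_ : Bool → Bool → Bool
true  == b = b
false == b = not b

≡⇒== : ∀ {a b} → a ≡ b → a == b ≡ true
≡⇒== {true}  refl = refl
≡⇒== {false} refl = refl

==⇒≡ : ∀ {a b} → a == b ≡ true → b ≡ a
==⇒≡ {true}  {true}  _ = refl
==⇒≡ {false} {false} _ = refl

≡∨≡not : ∀ a b → a ≡ b ⊎ a ≡ not b
≡∨≡not true  true  = inj₁ refl
≡∨≡not true  false = inj₂ refl
≡∨≡not false true  = inj₂ refl
≡∨≡not false false = inj₁ refl

not-x==x : ∀ b → not b == b ≡ false
not-x==x true  = refl
not-x==x false = refl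

eqᵇ-refl : ∀ {k} (i : Fin k) → eqᵇ i i ≡ true
eqᵇ-refl i with i ≟ i
... | yes _   = refl
... | no i≢i = ⊥-elim (i≢i refl)

eqᵇ⇒≡ : ∀ {k} {i j : Fin k} → eqᵇ i j ≡ true → i ≡ j
eqᵇ⇒≡ {i = i} {j} eq with i ≟ j
... | yes i≡j = i≡j

-- Counting

indicator : Bool → ℕ
indicator true  = 1
indicator false = 0

count : ∀ {k} → (Fin k → Bool) → ℕ
count {k} f = ∑[ i < k ] indicator (f i)

sum-mono-≤ : ∀ {k} {f g : Fin k → ℕ} → (∀ i → f i ≤ g i) → sum f ≤ sum g
sum-mono-≤ {zero}  f≤g = z≤n
sum-mono-≤ {suc k} f≤g = +-mono-≤ (f≤g Fin.zero) (sum-mono-≤ (f≤g ∘ Fin.suc))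

∣tabulate∣≡count : ∀ {k} (f : Fin k → Bool) → ∣ tabulate f ∣ ≡ count f
∣tabulate∣≡count {zero}  f = refl
∣tabulate∣≡count {suc k} f with f Fin.zero
... | true  = cong suc (∣tabulate∣≡count (f ∘ Fin.suc))
... | false = ∣tabulate∣≡count (f ∘ Fin.suc)

∣p∣≡count : ∀ {k} (p : Subset k) → ∣ p ∣ ≡ count (lookup p)
∣p∣≡count p = trans (cong ∣_∣ (sym (tabulate∘lookup p))) (∣tabulate∣≡count (lookup p))

indicator-mono : ∀ {a b} → (a ≡ true → b ≡ true) → indicator a ≤ indicator b
indicator-mono {false} a⇒b = z≤n
indicator-mono {true}  a⇒b rewrite a⇒b refl = ≤-refl

count-mono : ∀ {k} {f g : Fin k → Bool} →
  (∀ i → f i ≡ true → g i ≡ true) → count f ≤ count g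
count-mono f⊆g = sum-mono-≤ (indicator-mono ∘ f⊆g)

count-∨ : ∀ {k} (f g : Fin k → Bool) → count (λ i → f i ∨ g i) ≤ count f + count g
count-∨ f g = ≤-trans (sum-mono-≤ pointwise) (≤-reflexive (∑-distrib-+ (indicator ∘ f) (indicator ∘ g)))
  where
  pointwise : ∀ i → indicator (f i ∨ g i) ≤ indicator (f i) + indicator (g i)
  pointwise i with f i | g i
  ... | true  | _     = s≤s z≤n
  ... | false | true  = ≤-refl
  ... | false | false = z≤n

count-partition : ∀ {k} (c f : Fin k → Bool) →
  count (λ i → c i ∧ f i) + count (λ i → not (c i) ∧ f i) ≡ count f
count-partition c f =
  trans (sym (∑-distrib-+ (λ i → indicator (c i ∧ f i)) (λ i → indicator (not (c i) ∧ f i))))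
        (sum-cong-≗ pointwise)
  where
  pointwise : ∀ i → indicator (c i ∧ f i) + indicator (not (c i) ∧ f i) ≡ indicator (f i)
  pointwise i with c i | f i
  ... | true  | true  = refl
  ... | true  | false = refl
  ... | false | true  = refl
  ... | false | false = refl

count≡0 : ∀ {k} (f : Fin k → Bool) → (∀ i → f i ≡ false) → count f ≡ 0
count≡0 {zero}  f none = refl
count≡0 {suc k} f none rewrite none Fin.zero = count≡0 (f ∘ Fin.suc) (none ∘ Fin.suc)

count≤1 : ∀ {k} (f : Fin k → Bool) →
  (∀ i j → f i ≡ true → f j ≡ true → i ≡ j) → count f ≤ 1
count≤1 {zero}  f unique = z≤n
count≤1 {suc k} f unique with f Fin.zero in f₀
... | true  = ≤-reflexive (cong suc (count≡0 (f ∘ Fin.suc) rest))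
  where
  rest : ∀ i → f (Fin.suc i) ≡ false
  rest i with f (Fin.suc i) in fᵢ
  ... | false = refl
  ... | true with () ← unique Fin.zero (Fin.suc i) f₀ fᵢ
... | false = count≤1 (f ∘ Fin.suc) λ i j fᵢ fⱼ →
  Fin.suc-injective (unique (Fin.suc i) (Fin.suc j) fᵢ fⱼ)

count-eqᵇ∘inj≤1 : ∀ {k} (i : Fin k) {f : Fin k → Fin k} → (∀ {a b} → f a ≡ f b → a ≡ b) →
  count (λ j → eqᵇ i (f j)) ≤ 1
count-eqᵇ∘inj≤1 i {f} inj =
  count≤1 (λ j → eqᵇ i (f j)) λ a b eqa eqb → inj (trans (sym (eqᵇ⇒≡ eqa)) (eqᵇ⇒≡ eqb))

count-eqᵇ≤1 : ∀ {k} (i : Fin k) → count (λ j → eqᵇ j i) ≤ 1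
count-eqᵇ≤1 i = count≤1 (λ j → eqᵇ j i) λ a b eqa eqb → trans (eqᵇ⇒≡ eqa) (sym (eqᵇ⇒≡ eqb))

count-pigeonhole : ∀ {k} (f g : Fin k → Bool) → count g < count f →
  ∃ λ i → f i ≡ true × g i ≡ false
count-pigeonhole {suc k} f g g<f with f Fin.zero in f₀ | g Fin.zero in g₀
... | true  | false = Fin.zero , f₀ , g₀
... | true  | true  = map Fin.suc id (count-pigeonhole (f ∘ Fin.suc) (g ∘ Fin.suc) (≤-pred g<f))
... | false | true  = map Fin.suc id (count-pigeonhole (f ∘ Fin.suc) (g ∘ Fin.suc) (<-trans (n<1+n _) g<f))
... | false | false = map Fin.suc id (count-pigeonhole (f ∘ Fin.suc) (g ∘ Fin.suc) g<f)

⊆∧count≤⇒≗ : ∀ {k} (f g : Fin k → Bool) → (∀ i → f i ≡ true → g i ≡ true) →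
  count g ≤ count f → ∀ i → f i ≡ g i
⊆∧count≤⇒≗ f g f⊆g g≤f Fin.zero with f Fin.zero | g Fin.zero | f⊆g Fin.zero
... | true  | true  | _   = refl
... | false | false | _   = refl
... | true  | false | f⇒g with () ← f⇒g refl
... | false | true  | _   = ⊥-elim (<⇒≱ (s≤s (count-mono (f⊆g ∘ Fin.suc))) g≤f)
⊆∧count≤⇒≗ f g f⊆g g≤f (Fin.suc i) =
  ⊆∧count≤⇒≗ (f ∘ Fin.suc) (g ∘ Fin.suc) (f⊆g ∘ Fin.suc) tail-≤ i
  where
  tail-≤ : count (g ∘ Fin.suc) ≤ count (f ∘ Fin.suc)
  tail-≤ = +-cancelˡ-≤ (indicator (g Fin.zero)) _ _
             (≤-trans g≤f (+-monoˡ-≤ _ (indicator-mono (f⊆g Fin.zero))))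

count-side≥ : ∀ {m d} (col : Fin m → Bool) → d ≤ ∣ XSet col ∣ → d ≤ ∣ YSet col ∣ →
  ∀ b → d ≤ count (λ v → b == col v)
count-side≥ col X-large Y-large true  = ≤-trans X-large (≤-reflexive (∣tabulate∣≡count col))
count-side≥ col X-large Y-large false = ≤-trans Y-large (≤-reflexive (∣tabulate∣≡count (not ∘ col)))

sum-↑ : ∀ {a b} (g : Fin (a + b) → ℕ) → sum g ≡ sum (g ∘ (_↑ˡ b)) + sum (g ∘ (a ↑ʳ_))
sum-↑ {zero}      g = refl
sum-↑ {suc a} {b} g =
  trans (cong (g Fin.zero +_) (sum-↑ {a} {b} (g ∘ Fin.suc))) (sym (+-assoc (g Fin.zero) _ _))

sum-combine : ∀ {a b} (g : Fin (a * b) → ℕ) → sum g ≡ ∑[ v < a ] ∑[ j < b ] g (combine v j)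
sum-combine {zero}      g = refl
sum-combine {suc a} {b} g =
  trans (sum-↑ {b} {a * b} g) (cong (sum (g ∘ (_↑ˡ (a * b))) +_) (sum-combine {a} {b} (g ∘ (b ↑ʳ_))))

sumBelow : ℕ → (ℕ → ℕ) → ℕ
sumBelow N g = ∑[ t < N ] g (toℕ t)

sumBelow-cong : ∀ N {g h : ℕ → ℕ} → (∀ t → g t ≡ h t) → sumBelow N g ≡ sumBelow N h
sumBelow-cong N g≗h = sum-cong-≗ {N} (g≗h ∘ toℕ)

sumBelow-+ : ∀ N (g h : ℕ → ℕ) → sumBelow N (λ t → g t + h t) ≡ sumBelow N g + sumBelow N h
sumBelow-+ N g h = ∑-distrib-+ {N} (g ∘ toℕ) (h ∘ toℕ)

sumBelow-snoc : ∀ N (g : ℕ → ℕ) → sumBelow (suc N) g ≡ sumBelow N g + g N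
sumBelow-snoc zero    g = +-comm (g 0) 0
sumBelow-snoc (suc N) g = trans (cong (g 0 +_) (sumBelow-snoc N (g ∘ suc))) (sym (+-assoc (g 0) _ _))

sumBelow-rotate : ∀ N (g : ℕ → ℕ) → g N ≡ g 0 → sumBelow N (g ∘ suc) ≡ sumBelow N g
sumBelow-rotate N g gN≡g0 = +-cancelʳ-≡ (g 0) _ _ (begin
  sumBelow N (g ∘ suc) + g 0 ≡⟨ +-comm _ (g 0) ⟩
  sumBelow (suc N) g         ≡⟨ sumBelow-snoc N g ⟩
  sumBelow N g + g N         ≡⟨ cong (sumBelow N g +_) gN≡g0 ⟩
  sumBelow N g + g 0         ∎)
  where open ≡-Reasoning

sumBelow-periodic : ∀ N (g : ℕ → ℕ) → (∀ s → g (N + s) ≡ g s) →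
  ∀ a → sumBelow N (λ t → g (t + a)) ≡ sumBelow N g
sumBelow-periodic N g periodic zero    = sumBelow-cong N (λ t → cong g (+-identityʳ t))
sumBelow-periodic N g periodic (suc a) = begin
  sumBelow N (λ t → g (t + suc a))   ≡⟨ sumBelow-cong N (λ t → cong g (+-suc t a)) ⟩
  sumBelow N (λ t → g (suc t + a))   ≡⟨ sumBelow-rotate N (λ t → g (t + a)) (periodic a) ⟩
  sumBelow N (λ t → g (t + a))       ≡⟨ sumBelow-periodic N g periodic a ⟩
  sumBelow N g                       ∎
  where open ≡-Reasoning

sumBelow-pairs : ∀ N (g : ℕ → ℕ) → sumBelow (2 * N) g ≡ sumBelow N (λ i → g (2 * i) + g (2 * i + 1))
sumBelow-pairs zero    g = refl
sumBelow-pairs (suc N) g = begin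
  sumBelow (2 * suc N) g
    ≡⟨ cong (λ M → sumBelow M g) (*-suc 2 N) ⟩
  g 0 + (g 1 + sumBelow (2 * N) (g ∘ suc ∘ suc))
    ≡⟨ sym (+-assoc (g 0) (g 1) _) ⟩
  g 0 + g 1 + sumBelow (2 * N) (g ∘ suc ∘ suc)
    ≡⟨ cong (g 0 + g 1 +_) (sumBelow-pairs N (g ∘ suc ∘ suc)) ⟩
  g 0 + g 1 + sumBelow N (λ i → g (2 + 2 * i) + g (2 + (2 * i + 1)))
    ≡⟨ cong (g 0 + g 1 +_) (sumBelow-cong N (λ i → cong₂ _+_ (cong g (sym (*-suc 2 i)))
                                                           (cong (λ k → g (k + 1)) (sym (*-suc 2 i))))) ⟩
  g 0 + g 1 + sumBelow N (λ i → g (2 * suc i) + g (2 * suc i + 1))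
    ∎
  where open ≡-Reasoning

term≤sumBelow : ∀ {N i} (g : ℕ → ℕ) → i < N → g i ≤ sumBelow N g
term≤sumBelow {suc N} {zero}  g _         = m≤m+n (g 0) _
term≤sumBelow {suc N} {suc i} g (s≤s i<N) = ≤-trans (term≤sumBelow (g ∘ suc) i<N) (m≤n+m _ (g 0))

terms≤sumBelow₂ : ∀ {N i j} (g : ℕ → ℕ) → i < j → j < N → g i + g j ≤ sumBelow N g
terms≤sumBelow₂ {suc N} {zero}  {suc j} g _ (s≤s j<N) = +-monoʳ-≤ (g 0) (term≤sumBelow (g ∘ suc) j<N)
terms≤sumBelow₂ {suc N} {suc i} {suc j} g (s≤s i<j) (s≤s j<N) =
  ≤-trans (terms≤sumBelow₂ (g ∘ suc) i<j j<N) (m≤n+m _ (g 0))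

terms≤sumBelow₃ : ∀ {N i j l} (g : ℕ → ℕ) → i < j → j < l → l < N →
  g i + g j + g l ≤ sumBelow N g
terms≤sumBelow₃ {suc N} {zero} {suc j} {suc l} g _ (s≤s j<l) (s≤s l<N) =
  ≤-trans (≤-reflexive (+-assoc (g 0) (g (suc j)) _)) (+-monoʳ-≤ (g 0) (terms≤sumBelow₂ (g ∘ suc) j<l l<N))
terms≤sumBelow₃ {suc N} {suc i} {suc j} {suc l} g (s≤s i<j) (s≤s j<l) (s≤s l<N) =
  ≤-trans (terms≤sumBelow₃ (g ∘ suc) i<j j<l l<N) (m≤n+m _ (g 0))

sumBelow<⇒small-term : ∀ N (g : ℕ → ℕ) κ → sumBelow N g < N * κ → ∃ λ s → s < N × g s < κ
sumBelow<⇒small-term (suc N) g κ sum< with g 0 <? κ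
... | yes g0<κ = 0 , s≤s z≤n , g0<κ
... | no  g0≮κ = map suc (map s≤s id) (sumBelow<⇒small-term N (g ∘ suc) κ
                   (+-cancelˡ-< κ _ _ (≤-<-trans (+-monoˡ-≤ _ (≮⇒≥ g0≮κ)) sum<)))

x+w+y≤2d⇒w≡0 : ∀ {x w y d} → x + w + y ≤ 2 * d → d ≤ x → d ≤ y → w ≡ 0
x+w+y≤2d⇒w≡0 {x} {w} {y} {d} sum≤2d d≤x d≤y = n≤0⇒n≡0 (+-cancelʳ-≤ (d + d) w 0 (begin
  w + (d + d)   ≡⟨ sym (+-assoc w d d) ⟩
  w + d + d     ≡⟨ cong (_+ d) (+-comm w d) ⟩
  d + w + d     ≤⟨ +-mono-≤ (+-monoˡ-≤ w d≤x) d≤y ⟩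
  x + w + y     ≤⟨ sum≤2d ⟩
  2 * d         ≡⟨ cong (d +_) (+-identityʳ d) ⟩
  d + d         ∎))
  where open ≤-Reasoning

x+y≤2d⇒x≤d : ∀ {x y d} → x + y ≤ 2 * d → d ≤ y → x ≤ d
x+y≤2d⇒x≤d {x} {y} {d} sum≤2d d≤y = +-cancelʳ-≤ d x d (begin
  x + d   ≤⟨ +-monoʳ-≤ x d≤y ⟩
  x + y   ≤⟨ sum≤2d ⟩
  2 * d   ≡⟨ cong (d +_) (+-identityʳ d) ⟩
  d + d   ∎)
  where open ≤-Reasoning


¬¬-descent : ∀ (P : ℕ → Set) {i j} → P i → ¬ P j → i ≤ j →
  ¬ ¬ (∃ λ t → i ≤ t × t < j × P t × ¬ P (suc t))
¬¬-descent P {j = zero}  Pᵢ ¬Pⱼ z≤n    _ = ¬Pⱼ Pᵢ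
¬¬-descent P {j = suc j} Pᵢ ¬Pⱼ i≤1+j no-descent with m≤n⇒m<n∨m≡n i≤1+j
... | inj₂ refl = ¬Pⱼ Pᵢ
... | inj₁ i<1+j = ¬¬-excluded-middle λ where
  (yes Pⱼ)  → no-descent (j , ≤-pred i<1+j , n<1+n j , Pⱼ , ¬Pⱼ)
  (no ¬Pⱼ′) → ¬¬-descent P Pᵢ ¬Pⱼ′ (≤-pred i<1+j) λ (t , i≤t , t<j , Pₜ , ¬Pₜ₊₁) →
                no-descent (t , i≤t , ≤-trans t<j (n≤1+n j) , Pₜ , ¬Pₜ₊₁)

-- Reachability and cuts

module _ {m} {A : Adj m} {S : Subset m} where

  Reach-source : ∀ {u v} → Reach A S u v → lookup S u ≡ false
  Reach-source (here u∉S)     = u∉S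
  Reach-source (step u∉S _ _) = u∉S

  Reach-snoc : ∀ {u w v} → Reach A S u w → lookup S v ≡ false → A w v ≡ true → Reach A S u v
  Reach-snoc (here w∉S)         v∉S wv = step w∉S wv (here v∉S)
  Reach-snoc (step u∉S uw′ w′w) v∉S wv = step u∉S uw′ (Reach-snoc w′w v∉S wv)

  Reach-trans : ∀ {u w v} → Reach A S u w → Reach A S w v → Reach A S u v
  Reach-trans (here _)           wv = wv
  Reach-trans (step u∉S uw′ w′w) wv = step u∉S uw′ (Reach-trans w′w wv)

  Reach-sym : (∀ u v → A u v ≡ A v u) → ∀ {u v} → Reach A S u v → Reach A S v u
  Reach-sym sym-A (here v∉S)              = here v∉S
  Reach-sym sym-A (step {u} {w} u∉S uw wv) = Reach-snoc (Reach-sym sym-A wv) u∉S (trans (sym-A w u) uw)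

  isolated⇒¬Reach : ∀ {w u} → (∀ x → A w x ≡ true → lookup S x ≡ true) → u ≢ w → ¬ Reach A S w u
  isolated⇒¬Reach N⊆S u≢w (here _)           = u≢w refl
  isolated⇒¬Reach N⊆S u≢w (step {w = x} _ wx xu) with () ← trans (sym (N⊆S x wx)) (Reach-source xu)

module _ {m} {A : Adj m} where

  Nbhd-isCut : ∀ {w u} → A w w ≡ false → A w u ≡ false → u ≢ w → IsCut A (Nbhd A w)
  Nbhd-isCut {w} {u} ww wu u≢w =
    w , u , trans (lookup∘tabulate (A w) w) ww , trans (lookup∘tabulate (A w) u) wu ,
    isolated⇒¬Reach (λ x wx → trans (lookup∘tabulate (A w) x) wx) u≢w

  nonadjacent⇒¬Complete : ∀ {w u} → u ≢ w → A w u ≡ false → ¬ Complete A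
  nonadjacent⇒¬Complete u≢w wu complete with () ← trans (sym (complete _ _ (u≢w ∘ sym))) wu

  connectivity≤cut : ∀ {k} → IsConnectivity A k → ¬ Complete A → ∀ S → IsCut A S → k ≤ ∣ S ∣
  connectivity≤cut (inj₁ (complete , _))    ¬complete = ⊥-elim (¬complete complete)
  connectivity≤cut (inj₂ (_ , _ , k≤cuts)) _         = k≤cuts

  min-cut⊇Nbhd⇒≡Nbhd : ∀ {k S x} → (∀ y → IsCut A (Nbhd A y)) → (∀ T → IsCut A T → k ≤ ∣ T ∣) →
    ∣ S ∣ ≡ k → (∀ y → A x y ≡ true → lookup S y ≡ true) →
    ∃ λ v → S ≡ Nbhd A v × (∀ w → deg A v ≤ deg A w)
  min-cut⊇Nbhd⇒≡Nbhd {k} {S} {x} Nbhd-cut k≤cut ∣S∣≡k N⊆S = x , S≡N , minimum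
    where
    ∣S∣≤deg : count (lookup S) ≤ count (A x)
    ∣S∣≤deg = subst₂ _≤_ (trans (sym ∣S∣≡k) (∣p∣≡count S)) (∣tabulate∣≡count (A x))
                       (k≤cut _ (Nbhd-cut x))
    S≡N : S ≡ Nbhd A x
    S≡N = trans (sym (tabulate∘lookup S))
                (tabulate-cong (λ y → sym (⊆∧count≤⇒≗ (A x) (lookup S) N⊆S ∣S∣≤deg y)))
    minimum : ∀ w → deg A x ≤ deg A w
    minimum w = subst (_≤ deg A w) (trans (sym ∣S∣≡k) (cong ∣_∣ S≡N)) (k≤cut _ (Nbhd-cut w))

non-neighbour-across : ∀ {m d} {A : Adj m} (col : Fin m → Bool) →
  suc d ≤ ∣ XSet col ∣ → suc d ≤ ∣ YSet col ∣ →
  ∀ w → deg A w ≡ d → ∃ λ u → u ≢ w × A w u ≡ false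
non-neighbour-across {A = A} col X-large Y-large w deg-w
  with count-pigeonhole (λ u → not (col w) == col u) (A w)
         (subst (_< count (λ u → not (col w) == col u)) (trans (sym deg-w) (∣tabulate∣≡count (A w)))
                (count-side≥ col X-large Y-large (not (col w))))
... | u , across , w≁u = u , (λ { refl → contradiction (trans (sym across) (not-x==x (col w))) λ () }) , w≁u

-- Cyclic positions

toℕ-csuc : ∀ {n} (i : Fin (suc n)) → toℕ (csuc i) ≡ suc (toℕ i) % suc n
toℕ-csuc {n} i with suc (toℕ i) <? suc n
... | yes 1+i<n = trans (toℕ-fromℕ< 1+i<n) (sym (m<n⇒m%n≡m 1+i<n))
... | no  1+i≮n = sym (trans (cong (_% suc n) (≤-antisym (toℕ<n i) (≮⇒≥ 1+i≮n))) (n%n≡0 (suc n)))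

toℕ-mod : ∀ {n} h → toℕ (h mod suc n) ≡ h % suc n
toℕ-mod {n} h = toℕ-fromℕ< (m%n<n h (suc n))

csuc-mod : ∀ {n} h → csuc (h mod suc n) ≡ suc h mod suc n
csuc-mod {n} h = toℕ-injective (begin
  toℕ (csuc (h mod N))  ≡⟨ toℕ-csuc (h mod N) ⟩
  suc (toℕ (h mod N)) % N ≡⟨ cong (λ r → suc r % N) (toℕ-mod h) ⟩
  (1 + h % N) % N       ≡⟨ %-distribˡ-+ 1 (h % N) N ⟩
  (1 % N + h % N % N) % N ≡⟨ cong (λ r → (1 % N + r) % N) (m%n%n≡m%n h N) ⟩
  (1 % N + h % N) % N   ≡⟨ sym (%-distribˡ-+ 1 h N) ⟩
  suc h % N             ≡⟨ sym (toℕ-mod (suc h)) ⟩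
  toℕ (suc h mod N)     ∎)
  where
  N : ℕ
  N = suc n
  open ≡-Reasoning

csuc-injective : ∀ {n} {i j : Fin n} → csuc i ≡ csuc j → i ≡ j
csuc-injective {suc n} {i} {j} eq with suc (toℕ i) <? suc n | suc (toℕ j) <? suc n
... | yes i<n | yes j<n = toℕ-injective (suc-injective (begin
  suc (toℕ i)          ≡⟨ sym (toℕ-fromℕ< i<n) ⟩
  toℕ (fromℕ< i<n)     ≡⟨ cong toℕ eq ⟩
  toℕ (fromℕ< j<n)     ≡⟨ toℕ-fromℕ< j<n ⟩
  suc (toℕ j)          ∎))
  where open ≡-Reasoning
... | yes i<n | no _ = ⊥-elim (1+n≢0 (trans (sym (toℕ-fromℕ< i<n)) (cong toℕ eq)))
... | no _ | yes j<n = ⊥-elim (1+n≢0 (trans (sym (toℕ-fromℕ< j<n)) (cong toℕ (sym eq))))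
... | no i≮n | no j≮n = toℕ-injective (suc-injective (trans (last i i≮n) (sym (last j j≮n))))
  where
  last : ∀ k → ¬ suc (toℕ k) < suc n → suc (toℕ k) ≡ suc n
  last k k≮n = ≤-antisym (toℕ<n k) (≮⇒≥ k≮n)

csuc-≢ : ∀ {n} → 2 ≤ n → (i : Fin n) → csuc i ≢ i
csuc-≢ {suc n} (s≤s 1≤n) i eq with suc (toℕ i) <? suc n
... | yes i<n = 1+n≢n (trans (sym (toℕ-fromℕ< i<n)) (cong toℕ eq))
... | no  i≮n with refl ← eq = i≮n (s≤s 1≤n)

isX : ℕ → Bool
isX zero    = true
isX (suc s) = not (isX s)

isX-2k+ : ∀ k s → isX (2 * k + s) ≡ isX s
isX-2k+ zero    s = refl
isX-2k+ (suc k) s = begin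
  isX (2 * suc k + s)         ≡⟨ cong (λ r → isX (r + s)) (*-suc 2 k) ⟩
  not (not (isX (2 * k + s))) ≡⟨ not-involutive _ ⟩
  isX (2 * k + s)             ≡⟨ isX-2k+ k s ⟩
  isX s                       ∎
  where open ≡-Reasoning

⌊2k+s/2⌋ : ∀ k s → ⌊ 2 * k + s /2⌋ ≡ k + ⌊ s /2⌋
⌊2k+s/2⌋ zero    s = refl
⌊2k+s/2⌋ (suc k) s = trans (cong (λ r → ⌊ r + s /2⌋) (*-suc 2 k)) (cong suc (⌊2k+s/2⌋ k s))

⌊1+s/2⌋ˣ : ∀ s → isX s ≡ true → ⌊ suc s /2⌋ ≡ ⌊ s /2⌋
⌊1+s/2⌋ʸ : ∀ s → isX s ≡ false → ⌊ suc s /2⌋ ≡ suc ⌊ s /2⌋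
⌊1+s/2⌋ˣ zero          _ = refl
⌊1+s/2⌋ˣ (suc (suc s)) x = cong suc (⌊1+s/2⌋ˣ s (trans (sym (not-involutive _)) x))
⌊1+s/2⌋ʸ (suc zero)    _ = refl
⌊1+s/2⌋ʸ (suc (suc s)) y = cong suc (⌊1+s/2⌋ʸ s (trans (sym (not-involutive _)) y))

-- Position s is the half-layer X_⌊s/2⌋ for even s and Y_⌊s/2⌋ for odd s, layers taken mod n.
module Positions (n′ : ℕ) where

  n : ℕ
  n = suc n′

  layer : ℕ → Fin n
  layer s = ⌊ s /2⌋ mod n

  layer-sucˣ : ∀ s → isX s ≡ true → layer (suc s) ≡ layer s
  layer-sucˣ s x = cong (_mod n) (⌊1+s/2⌋ˣ s x)

  layer-sucʸ : ∀ s → isX s ≡ false → layer (suc s) ≡ csuc (layer s)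
  layer-sucʸ s y = trans (cong (_mod n) (⌊1+s/2⌋ʸ s y)) (sym (csuc-mod ⌊ s /2⌋))

  layer-2k+ : ∀ k s → layer (2 * k + s) ≡ (k + ⌊ s /2⌋) mod n
  layer-2k+ k s = cong (_mod n) (⌊2k+s/2⌋ k s)

  layer-periodic : ∀ s → layer (2 * n + s) ≡ layer s
  layer-periodic s = trans (layer-2k+ n s) (toℕ-injective (begin
    toℕ ((n + ⌊ s /2⌋) mod n) ≡⟨ toℕ-mod (n + ⌊ s /2⌋) ⟩
    (n + ⌊ s /2⌋) % n         ≡⟨ cong (_% n) (+-comm n _) ⟩
    (⌊ s /2⌋ + n) % n         ≡⟨ [m+n]%n≡m%n ⌊ s /2⌋ n ⟩
    ⌊ s /2⌋ % n               ≡⟨ sym (toℕ-mod ⌊ s /2⌋) ⟩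
    toℕ (layer s)             ∎))
    where open ≡-Reasoning

  layer-2i+ : ∀ (i : Fin n) s → ⌊ s /2⌋ ≡ 0 → layer (2 * toℕ i + s) ≡ i
  layer-2i+ i s ⌊s/2⌋≡0 = trans (layer-2k+ (toℕ i) s) (toℕ-injective (begin
    toℕ ((toℕ i + ⌊ s /2⌋) mod n) ≡⟨ toℕ-mod (toℕ i + ⌊ s /2⌋) ⟩
    (toℕ i + ⌊ s /2⌋) % n         ≡⟨ cong (λ r → (toℕ i + r) % n) ⌊s/2⌋≡0 ⟩
    (toℕ i + 0) % n               ≡⟨ cong (_% n) (+-identityʳ (toℕ i)) ⟩
    toℕ i % n                     ≡⟨ m<n⇒m%n≡m (toℕ<n i) ⟩
    toℕ i                         ∎))
    where open ≡-Reasoning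

  layer-even : ∀ (i : Fin n) → layer (2 * toℕ i) ≡ i
  layer-even i = trans (cong layer (sym (+-identityʳ (2 * toℕ i)))) (layer-2i+ i 0 refl)

  layer-odd : ∀ (i : Fin n) → layer (2 * toℕ i + 1) ≡ i
  layer-odd i = layer-2i+ i 1 refl

  isX-even : ∀ k → isX (2 * k) ≡ true
  isX-even k = trans (cong isX (sym (+-identityʳ (2 * k)))) (isX-2k+ k 0)

  isX-odd : ∀ k → isX (2 * k + 1) ≡ false
  isX-odd k = isX-2k+ k 1

  position-of : ∀ (i : Fin n) b → ∃ λ s → s < 2 * n × layer s ≡ i × isX s ≡ b
  position-of i true  = 2 * toℕ i , *-monoʳ-< 2 (toℕ<n i) , layer-even i , isX-even (toℕ i)
  position-of i false = 2 * toℕ i + 1 , 2k+1<2n , layer-odd i , isX-odd (toℕ i)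
    where
    2k+1<2n : 2 * toℕ i + 1 < 2 * n
    2k+1<2n = ≤-trans (≤-reflexive (trans (cong suc (+-comm (2 * toℕ i) 1)) (sym (*-suc 2 (toℕ i)))))
                      (*-monoʳ-≤ 2 (toℕ<n i))

-- The graph G̃

module Lift {m} (A : Adj m) (col : Fin m → Bool) (n′ : ℕ) where
  open Positions n′ public

  G̃ : Adj (m * n)
  G̃ = tildeAdj A col n

  link : Fin m → Fin n → Fin m → Fin n → Bool
  link u i v j = A u v ∧ (if col u
           then (not (col v) ∧ (eqᵇ i j ∨ eqᵇ i (csuc j)))
           else (col v ∧ (eqᵇ j i ∨ eqᵇ j (csuc i))))

  G̃-combine : ∀ u i v j → G̃ (combine u i) (combine v j) ≡ link u i v j
  G̃-combine u i v j =
    trans (G̃≡link (combine u i) (combine v j))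
          (cong₂ (λ (p q : Fin m × Fin n) → link (proj₁ p) (proj₂ p) (proj₁ q) (proj₂ q))
                 (remQuot-combine {m} {n} u i) (remQuot-combine {m} {n} v j))
    where
    G̃≡link : ∀ a b → G̃ a b ≡ link (proj₁ (remQuot {m} n a)) (proj₂ (remQuot {m} n a))
                                   (proj₁ (remQuot {m} n b)) (proj₂ (remQuot {m} n b))
    G̃≡link a b with remQuot {m} n a | remQuot {m} n b
    ... | _ , _ | _ , _ = refl

  LayerStep : Bool → Fin n → Fin n → Set
  LayerStep true  i j = i ≡ j ⊎ i ≡ csuc j
  LayerStep false i j = j ≡ i ⊎ j ≡ csuc i

  link-intro : ∀ {u i v j} → A u v ≡ true → col v ≡ not (col u) → LayerStep (col u) i j →
    link u i v j ≡ true
  link-intro {u} {i} {v} {j} uv cv layers rewrite uv | cv with col u | layers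
  ... | true  | inj₁ refl = ∨-introˡ (eqᵇ-refl i)
  ... | true  | inj₂ refl = ∨-introʳ (eqᵇ i j) (eqᵇ-refl i)
  ... | false | inj₁ refl = ∨-introˡ (eqᵇ-refl j)
  ... | false | inj₂ refl = ∨-introʳ (eqᵇ j i) (eqᵇ-refl j)

  link-elim : ∀ {u i v j} → link u i v j ≡ true →
    A u v ≡ true × col v ≡ not (col u) × LayerStep (col u) i j
  link-elim {u} {i} {v} {j} l with A u v | col u | col v
  link-elim () | false | _ | _
  link-elim () | true | true | true
  link-elim () | true | false | false
  ... | true | true  | false = refl , refl , map⊎ eqᵇ⇒≡ eqᵇ⇒≡ (∨-elim (eqᵇ i j) l)
  ... | true | false | true  = refl , refl , map⊎ eqᵇ⇒≡ eqᵇ⇒≡ (∨-elim (eqᵇ j i) l)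

  link-sym : (∀ u v → A u v ≡ A v u) → ∀ u i v j → link u i v j ≡ link v j u i
  link-sym sym-A u i v j with A u v | A v u | sym-A u v | col u | col v
  ... | false | false | _ | _     | _     = refl
  ... | true  | true  | _ | true  | true  = refl
  ... | true  | true  | _ | true  | false = refl
  ... | true  | true  | _ | false | true  = refl
  ... | true  | true  | _ | false | false = refl

  link-irrefl : (∀ v → A v v ≡ false) → ∀ u i j → link u i u j ≡ false
  link-irrefl irrefl-A u i j rewrite irrefl-A u = refl

  G̃-sym : (∀ u v → A u v ≡ A v u) → ∀ a b → G̃ a b ≡ G̃ b a
  G̃-sym sym-A a b with combine-surjective {m} {n} a | combine-surjective {m} {n} b
  ... | u , i , refl | v , j , refl =
    trans (G̃-combine u i v j) (trans (link-sym sym-A u i v j) (sym (G̃-combine v j u i)))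

  at : ℕ → Fin m → Fin (m * n)
  at s v = combine v (layer s)

  layerStep-suc : ∀ s → LayerStep (isX s) (layer s) (layer (suc s))
  layerStep-suc s with isX s in x
  ... | true  = inj₁ (sym (layer-sucˣ s x))
  ... | false = inj₂ (layer-sucʸ s x)

  layerStep-inverse : ∀ s {j} → LayerStep (isX (suc s)) (layer (suc s)) j →
    j ≡ layer s ⊎ j ≡ layer (suc (suc s))
  layerStep-inverse s {j} layers with isX s in x | layers
  ... | true  | inj₁ j≡ = inj₁ (trans j≡ (layer-sucˣ s x))
  ... | true  | inj₂ j≡ = inj₂ (trans j≡ (sym (layer-sucʸ (suc s) (cong not x))))
  ... | false | inj₁ ≡j = inj₂ (trans (sym ≡j) (sym (layer-sucˣ (suc s) (cong not x))))
  ... | false | inj₂ ≡j = inj₁ (csuc-injective (trans (sym ≡j) (layer-sucʸ s x)))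

  links-to-vertex≤2 : ∀ v i u → count (λ j → link v i u j) ≤ indicator (A v u) + indicator (A v u)
  links-to-vertex≤2 v i u with A v u | col v
  ... | false | _     = ≤-reflexive (count≡0 {n} (λ _ → false) (λ _ → refl))
  ... | true  | true  = ≤-trans (count-mono {g = λ j → eqᵇ i j ∨ eqᵇ i (csuc j)} (λ _ → ∧-elimʳ (not (col u))))
                          (≤-trans (count-∨ (λ j → eqᵇ i j) (λ j → eqᵇ i (csuc j)))
                            (+-mono-≤ (count-eqᵇ∘inj≤1 i id) (count-eqᵇ∘inj≤1 i csuc-injective)))
  ... | true  | false = ≤-trans (count-mono {g = λ j → eqᵇ j i ∨ eqᵇ j (csuc i)} (λ _ → ∧-elimʳ (col u)))
                          (≤-trans (count-∨ (λ j → eqᵇ j i) (λ j → eqᵇ j (csuc i)))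
                            (+-mono-≤ (count-eqᵇ≤1 i) (count-eqᵇ≤1 (csuc i))))

  deg-G̃ : ∀ v i → deg G̃ (combine v i) ≤ 2 * deg A v
  deg-G̃ v i = begin
    deg G̃ (combine v i)
      ≡⟨ ∣tabulate∣≡count (G̃ (combine v i)) ⟩
    count (G̃ (combine v i))
      ≡⟨ sum-combine {m} {n} (indicator ∘ G̃ (combine v i)) ⟩
    ∑[ u < m ] ∑[ j < n ] indicator (G̃ (combine v i) (combine u j))
      ≡⟨ sum-cong-≗ {m} (λ u → sum-cong-≗ {n} (λ j → cong indicator (G̃-combine v i u j))) ⟩
    ∑[ u < m ] count (λ j → link v i u j)
      ≤⟨ sum-mono-≤ (links-to-vertex≤2 v i) ⟩
    ∑[ u < m ] (indicator (A v u) + indicator (A v u))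
      ≡⟨ ∑-distrib-+ {m} (indicator ∘ A v) (indicator ∘ A v) ⟩
    count (A v) + count (A v)
      ≡⟨ cong (count (A v) +_) (sym (+-identityʳ (count (A v)))) ⟩
    2 * count (A v)
      ≡⟨ cong (2 *_) (sym (∣tabulate∣≡count (A v))) ⟩
    2 * deg A v
      ∎
    where open ≤-Reasoning

  module _ (irrefl-A : ∀ v → A v v ≡ false) where

    G̃-irrefl : ∀ x → G̃ x x ≡ false
    G̃-irrefl x with combine-surjective {m} {n} x
    ... | v , i , refl = trans (G̃-combine v i v i) (link-irrefl irrefl-A v i i)

    G̃-non-neighbour : 2 ≤ n → ∀ x → ∃ λ x′ → x′ ≢ x × G̃ x x′ ≡ false
    G̃-non-neighbour 2≤n x with combine-surjective {m} {n} x
    ... | v , i , refl =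
      combine v (csuc i) ,
      (λ eq → csuc-≢ 2≤n i (combine-injectiveʳ v (csuc i) v i eq)) ,
      trans (G̃-combine v i v (csuc i)) (link-irrefl irrefl-A v i (csuc i))

    Nbhd-G̃-isCut : 2 ≤ n → ∀ x → IsCut G̃ (Nbhd G̃ x)
    Nbhd-G̃-isCut 2≤n x with G̃-non-neighbour 2≤n x
    ... | x′ , x′≢x , xx′ = Nbhd-isCut (G̃-irrefl x) xx′ x′≢x

    G̃-¬Complete : 2 ≤ n → Fin (m * n) → ¬ Complete G̃
    G̃-¬Complete 2≤n x with G̃-non-neighbour 2≤n x
    ... | x′ , x′≢x , xx′ = nonadjacent⇒¬Complete x′≢x xx′

    cuts≤2deg : 2 ≤ n → ∀ {k} → (∀ T → IsCut G̃ T → k ≤ ∣ T ∣) → ∀ v → k ≤ 2 * deg A v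
    cuts≤2deg 2≤n k≤cut v = ≤-trans (k≤cut _ (Nbhd-G̃-isCut 2≤n (combine v Fin.zero))) (deg-G̃ v Fin.zero)

-- Removing at most 2δ vertices

module Survivors {m} (A : Adj m) (col : Fin m → Bool) (n′ : ℕ)
  (sym-A : ∀ u v → A u v ≡ A v u) (bipartite : IsBipartition A col)
  (δ κ : ℕ) (1≤κ : 1 ≤ κ) (κ≤δ : κ ≤ δ) (δ≤deg : ∀ v → δ ≤ deg A v)
  (X-large : suc δ ≤ ∣ XSet col ∣) (Y-large : suc δ ≤ ∣ YSet col ∣)
  (κ≤cut : ∀ T → IsCut A T → κ ≤ ∣ T ∣)
  (S : Subset (m * suc n′)) where

  open Lift A col n′

  0<δ : 0 < δ
  0<δ = ≤-trans 1≤κ κ≤δ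

  Survives : Fin (m * n) → Set
  Survives x = lookup S x ≡ false

  NonIsolated : Fin (m * n) → Set
  NonIsolated x = ∃ λ y → G̃ x y ≡ true × Survives y

  edge-sym : ∀ {x y} → G̃ x y ≡ true → G̃ y x ≡ true
  edge-sym {x} {y} xy = trans (G̃-sym sym-A y x) xy

  _⇝_ : Fin (m * n) → Fin (m * n) → Set
  x ⇝ y = Reach G̃ S x y

  z : ℕ → ℕ
  z s = count (λ v → (isX s == col v) ∧ lookup S (at s v))

  -- The copy of G (an H_i or an H′_i) spanned by positions s and s + 1.
  copy : ℕ → Fin m → Fin (m * n)
  copy s v = if isX s == col v then at s v else at (suc s) v

  opposite-sides : ∀ {u v} → A u v ≡ true → col v ≡ not (col u)
  opposite-sides {u} {v} uv with col u | col v | bipartite u v uv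
  ... | true  | true  | ≢ = ⊥-elim (≢ refl)
  ... | true  | false | _ = refl
  ... | false | true  | _ = refl
  ... | false | false | ≢ = ⊥-elim (≢ refl)

  opposite-of-opposite : ∀ {u v b} → A u v ≡ true → col u ≡ not b → col v ≡ b
  opposite-of-opposite {b = b} uv cu = trans (opposite-sides uv) (trans (cong not cu) (not-involutive b))

  consecutive-edge : ∀ s {u v} → A u v ≡ true → col u ≡ isX s → G̃ (at s u) (at (suc s) v) ≡ true
  consecutive-edge s {u} {v} uv cu =
    trans (G̃-combine u (layer s) v (layer (suc s)))
          (link-intro uv (opposite-sides uv)
                      (subst (λ b → LayerStep b (layer s) (layer (suc s))) (sym cu) (layerStep-suc s)))

  copy-here : ∀ s {v} → col v ≡ isX s → copy s v ≡ at s v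
  copy-here s cv rewrite cv | ≡⇒== (refl {x = isX s}) = refl

  copy-there : ∀ s {v} → col v ≡ not (isX s) → copy s v ≡ at (suc s) v
  copy-there s cv rewrite cv with isX s
  ... | true  = refl
  ... | false = refl

  copy-edge : ∀ s {u v} → A u v ≡ true → G̃ (copy s u) (copy s v) ≡ true
  copy-edge s {u} {v} uv with ≡∨≡not (col u) (isX s)
  ... | inj₁ cu rewrite copy-here s cu | copy-there s (trans (opposite-sides uv) (cong not cu)) =
    consecutive-edge s uv cu
  ... | inj₂ cu rewrite copy-there s cu | copy-here s (opposite-of-opposite uv cu) =
    edge-sym (consecutive-edge s (trans (sym-A v u) uv) (opposite-of-opposite uv cu))

  deleted-from-copy : ℕ → Subset m
  deleted-from-copy s = tabulate (λ v → lookup S (copy s v))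

  copy-Reach : ∀ s {u v} → Reach A (deleted-from-copy s) u v → copy s u ⇝ copy s v
  copy-Reach s (here {v} v∉T)     = here (trans (sym (lookup∘tabulate _ v)) v∉T)
  copy-Reach s (step {u} u∉T uw wv) =
    step (trans (sym (lookup∘tabulate _ u)) u∉T) (copy-edge s uw) (copy-Reach s wv)

  ∣deleted-from-copy∣≤ : ∀ s → ∣ deleted-from-copy s ∣ ≤ z s + z (suc s)
  ∣deleted-from-copy∣≤ s = begin
    ∣ deleted-from-copy s ∣               ≡⟨ ∣tabulate∣≡count (λ v → lookup S (copy s v)) ⟩
    count (λ v → lookup S (copy s v))    ≤⟨ count-mono deleted-at-s-or-s+1 ⟩
    count (λ v → deletedAt s v ∨ deletedAt (suc s) v)  ≤⟨ count-∨ (deletedAt s) (deletedAt (suc s)) ⟩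
    z s + z (suc s)                      ∎
    where
    open ≤-Reasoning
    deletedAt : ℕ → Fin m → Bool
    deletedAt t v = (isX t == col v) ∧ lookup S (at t v)
    deleted-at-s-or-s+1 : ∀ v → lookup S (copy s v) ≡ true → deletedAt s v ∨ deletedAt (suc s) v ≡ true
    deleted-at-s-or-s+1 v deleted with isX s | col v
    ... | true  | true  = ∨-introˡ deleted
    ... | true  | false = deleted
    ... | false | true  = deleted
    ... | false | false = ∨-introˡ deleted

  copy-connected : ∀ s {u v} → z s + z (suc s) < κ → Survives (copy s u) → Survives (copy s v) →
    ¬ ¬ (copy s u ⇝ copy s v)
  copy-connected s {u} {v} few su sv ¬R =
    <⇒≱ (≤-<-trans (∣deleted-from-copy∣≤ s) few)
        (κ≤cut _ (u , v , trans (lookup∘tabulate _ u) su , trans (lookup∘tabulate _ v) sv , ¬R ∘ copy-Reach s))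

  survivor-at : ∀ s → z s ≤ δ → ∃ λ v → col v ≡ isX s × Survives (at s v)
  survivor-at s zₛ≤δ with count-pigeonhole (λ v → isX s == col v) (λ v → (isX s == col v) ∧ lookup S (at s v))
                              (≤-trans (s≤s zₛ≤δ) (count-side≥ col X-large Y-large (isX s)))
  ... | v , on-side , survives = v , ==⇒≡ on-side , ∧-true⇒false on-side survives

  surviving-neighbour : ∀ t {v} → col v ≡ not (isX t) → z t < δ →
    ∃ λ u → A v u ≡ true × col u ≡ isX t × Survives (at t u)
  surviving-neighbour t {v} cv zₜ<δ
    with count-pigeonhole (A v) (λ u → (isX t == col u) ∧ lookup S (at t u))
                          (<-≤-trans zₜ<δ (≤-trans (δ≤deg v) (≤-reflexive (∣tabulate∣≡count (A v)))))
  ... | u , vu , survives = u , vu , cu , ∧-true⇒false (≡⇒== (sym cu)) survives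
    where
    cu : col u ≡ isX t
    cu = opposite-of-opposite vu cv

  neighbour-below : ∀ s {v} → col v ≡ isX (suc s) → z s < δ →
    ∃ λ u → col u ≡ isX s × Survives (at s u) × G̃ (at s u) (at (suc s) v) ≡ true
  neighbour-below s cv zₛ<δ with surviving-neighbour s cv zₛ<δ
  ... | u , vu , cu , su = u , cu , su , consecutive-edge s (trans (sym-A _ _) vu) cu

  neighbour-above : ∀ s {v} → col v ≡ isX s → z (suc s) < δ →
    ∃ λ u → col u ≡ isX (suc s) × Survives (at (suc s) u) × G̃ (at s v) (at (suc s) u) ≡ true
  neighbour-above s cv zₛ₊₁<δ
    with surviving-neighbour (suc s) (trans cv (sym (not-involutive (isX s)))) zₛ₊₁<δ
  ... | u , vu , cu , su = u , cu , su , consecutive-edge s vu cv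

  neighbour-position : ∀ p {v x} → col v ≡ isX (suc p) → G̃ (at (suc p) v) x ≡ true →
    ∃ λ u → (x ≡ at p u × col u ≡ isX p) ⊎ (x ≡ at (suc (suc p)) u × col u ≡ isX (suc (suc p)))
  neighbour-position p {v} {x} cv vx with combine-surjective {m} {n} x
  ... | u , j , refl with link-elim {v} {layer (suc p)} {u} {j} (trans (sym (G̃-combine v (layer (suc p)) u j)) vx)
  ...   | vu , _ , layers with layerStep-inverse p (subst (λ b → LayerStep b (layer (suc p)) j) cv layers)
  ...     | inj₁ refl = u , inj₁ (refl , opposite-of-opposite vu cv)
  ...     | inj₂ refl = u , inj₂ (refl , trans (opposite-of-opposite vu cv) (sym (not-involutive (isX p))))

  z-at : ∀ s {i b} → layer s ≡ i → isX s ≡ b → z s ≡ count (λ v → (b == col v) ∧ lookup S (combine v i))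
  z-at s refl refl = refl

  z-periodic : ∀ s → z (2 * n + s) ≡ z s
  z-periodic s = z-at (2 * n + s) (layer-periodic s) (isX-2k+ n s)

  ∑z≡∣S∣ : sumBelow (2 * n) z ≡ ∣ S ∣
  ∑z≡∣S∣ = begin
    sumBelow (2 * n) z
      ≡⟨ sumBelow-pairs n z ⟩
    ∑[ i < n ] (z (2 * toℕ i) + z (2 * toℕ i + 1))
      ≡⟨ sum-cong-≗ {n} {λ i → z (2 * toℕ i) + z (2 * toℕ i + 1)} layer-total ⟩
    ∑[ i < n ] count (deleted i)
      ≡⟨ ∑-comm {n} {m} (λ i v → indicator (deleted i v)) ⟩
    ∑[ v < m ] ∑[ i < n ] indicator (deleted i v)
      ≡⟨ sym (sum-combine {m} {n} (indicator ∘ lookup S)) ⟩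
    count (lookup S)
      ≡⟨ sym (∣p∣≡count S) ⟩
    ∣ S ∣
      ∎
    where
    open ≡-Reasoning
    deleted : Fin n → Fin m → Bool
    deleted i v = lookup S (combine v i)
    layer-total : ∀ i → z (2 * toℕ i) + z (2 * toℕ i + 1) ≡ count (deleted i)
    layer-total i = trans (cong₂ _+_ (z-at (2 * toℕ i) (layer-even i) (isX-even (toℕ i)))
                                     (z-at (2 * toℕ i + 1) (layer-odd i) (isX-odd (toℕ i))))
                          (count-partition col (deleted i))

  light-copy : ∣ S ∣ ≤ 2 * δ → 2 * δ < n * κ → ∃ λ a → a < 2 * n × z a + z (suc a) < κ
  light-copy S≤2δ 2δ<nκ = sumBelow<⇒small-term (2 * n) (λ s → z s + z (suc s)) κ (begin-strict
    sumBelow (2 * n) (λ s → z s + z (suc s))   ≡⟨ sumBelow-+ (2 * n) z (z ∘ suc) ⟩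
    Σz + sumBelow (2 * n) (z ∘ suc)            ≡⟨ cong (Σz +_) (sumBelow-rotate (2 * n) z z₂ₙ≡z₀) ⟩
    Σz + Σz                                    ≤⟨ +-mono-≤ Σz≤2δ Σz≤2δ ⟩
    2 * δ + 2 * δ                              <⟨ +-mono-< 2δ<nκ 2δ<nκ ⟩
    n * κ + n * κ                              ≡⟨ cong (n * κ +_) (sym (+-identityʳ (n * κ))) ⟩
    2 * (n * κ)                                ≡⟨ sym (*-assoc 2 n κ) ⟩
    2 * n * κ                                  ∎)
    where
    open ≤-Reasoning
    Σz : ℕ
    Σz = sumBelow (2 * n) z
    z₂ₙ≡z₀ : z (2 * n) ≡ z 0
    z₂ₙ≡z₀ = trans (cong z (sym (+-identityʳ (2 * n)))) (z-periodic 0)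
    Σz≤2δ : Σz ≤ 2 * δ
    Σz≤2δ = ≤-trans (≤-reflexive ∑z≡∣S∣) S≤2δ

  light⇒z<δ : ∀ a → z a + z (suc a) < κ → z a < δ
  light⇒z<δ a light = <-≤-trans (≤-<-trans (m≤m+n _ _) light) κ≤δ

  ¬¬-snoc : ∀ {r x y} → ¬ ¬ (r ⇝ x) → Survives y → G̃ x y ≡ true → ¬ ¬ (r ⇝ y)
  ¬¬-snoc r⇝x sy xy = ¬¬-map (λ p → Reach-snoc p sy xy) r⇝x

  ¬¬-trans : ∀ {x y w} → ¬ ¬ (x ⇝ y) → ¬ ¬ (y ⇝ w) → ¬ ¬ (x ⇝ w)
  ¬¬-trans x⇝y y⇝w ¬x⇝w = x⇝y (λ p → y⇝w (λ q → ¬x⇝w (Reach-trans p q)))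

  -- Reachability in G̃ − S is not decided here, so it is only established up to double
  -- negation; this suffices since the theorem is finally obtained from a contradiction.
  AnchoredLayer : Fin (m * n) → Fin n → Bool → Set
  AnchoredLayer r i b = ∀ v → col v ≡ b → Survives (combine v i) → NonIsolated (combine v i) →
    ¬ ¬ (r ⇝ combine v i)

  Anchored : Fin (m * n) → ℕ → Set
  Anchored r s = AnchoredLayer r (layer s) (isX s)

  Anchored-stable : ∀ r s → Stable (Anchored r s)
  Anchored-stable r s ¬¬anchored v cv sv nv ¬r⇝v = ¬¬anchored (λ anchored → anchored v cv sv nv ¬r⇝v)

  Anchored-periodic : ∀ r s → Anchored r (2 * n + s) → Anchored r s
  Anchored-periodic r s = subst₂ (AnchoredLayer r) (layer-periodic s) (isX-2k+ n s)

  Anchored-periodic⁻¹ : ∀ r s → Anchored r s → Anchored r (2 * n + s)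
  Anchored-periodic⁻¹ r s = subst₂ (AnchoredLayer r) (sym (layer-periodic s)) (sym (isX-2k+ n s))

  anchored-up : ∀ {r} s → Anchored r s → z s < δ → Anchored r (suc s)
  anchored-up s anchored zₛ<δ v cv sv _ with neighbour-below s cv zₛ<δ
  ... | u , cu , su , uv = ¬¬-snoc (anchored u cu su (at (suc s) v , uv , sv)) sv uv

  anchored-down : ∀ {r} s → Anchored r (suc s) → z (suc s) < δ → Anchored r s
  anchored-down s anchored zₛ₊₁<δ v cv sv _ with neighbour-above s cv zₛ₊₁<δ
  ... | u , cu , su , vu = ¬¬-snoc (anchored u cu su (at s v , edge-sym vu , sv)) sv (edge-sym vu)

  anchored-across-gap : ∀ {r} p → Anchored r p → z p ≤ δ → z (suc p) ≡ 0 →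
    z (suc (suc p)) ≡ 0 ⊎ Anchored r (suc (suc p)) → Anchored r (suc p)
  anchored-across-gap p anchored zₚ≤δ zₚ₊₁≡0 (inj₁ zₚ₊₂≡0) v cv sv _ with survivor-at p zₚ≤δ
  ... | e , ce , se with neighbour-above p ce (subst (_< δ) (sym zₚ₊₁≡0) 0<δ)
  ...   | u , cu , su , eu =
    ¬¬-trans (¬¬-snoc (anchored e ce se (at (suc p) u , eu , su)) su eu)
             (subst₂ (λ x y → ¬ ¬ (x ⇝ y)) (copy-here (suc p) cu) (copy-here (suc p) cv)
                     (copy-connected (suc p) no-deletions
                        (subst Survives (sym (copy-here (suc p) cu)) su)
                        (subst Survives (sym (copy-here (suc p) cv)) sv)))
    where
    no-deletions : z (suc p) + z (suc (suc p)) < κ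
    no-deletions = subst₂ (λ a b → a + b < κ) (sym zₚ₊₁≡0) (sym zₚ₊₂≡0) 1≤κ
  anchored-across-gap p anchored _ _ (inj₂ anchoredₚ₊₂) v cv sv (x , vx , sx)
    with neighbour-position p cv vx
  ... | u , inj₁ (refl , cu) = ¬¬-snoc (anchored u cu sx (at (suc p) v , edge-sym vx , sv)) sv (edge-sym vx)
  ... | u , inj₂ (refl , cu) = ¬¬-snoc (anchoredₚ₊₂ u cu sx (at (suc p) v , edge-sym vx , sv)) sv (edge-sym vx)

  light-copy-anchor : ∀ a → z a + z (suc a) < κ → ∃ λ r → Anchored r a
  light-copy-anchor a light with survivor-at a (<⇒≤ (light⇒z<δ a light))
  ... | v₀ , c₀ , s₀ = at a v₀ , λ v cv sv _ →
    subst₂ (λ x y → ¬ ¬ (x ⇝ y)) (copy-here a c₀) (copy-here a cv)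
      (copy-connected a light (subst Survives (sym (copy-here a c₀)) s₀) (subst Survives (sym (copy-here a cv)) sv))

  module Sweep {r : Fin (m * n)} {a : ℕ} (a<2n : a < 2 * n) (zₐ<δ : z a < δ)
               (Σz≤2δ : sumBelow (2 * n) z ≤ 2 * δ) (anchoredₐ : Anchored r a) where

    Anchored′ : ℕ → Set
    Anchored′ t = Anchored r (t + a)

    z′ : ℕ → ℕ
    z′ t = z (t + a)

    Σz′≤2δ : sumBelow (2 * n) z′ ≤ 2 * δ
    Σz′≤2δ = ≤-trans (≤-reflexive (sumBelow-periodic (2 * n) z z-periodic a)) Σz≤2δ

    -- Losing and regaining the anchor forces δ ≤ z′ t₁ and δ ≤ z′ (t₂ + 1); as Σ z′ ≤ 2δ the
    -- positions strictly between are empty, and anchored-across-gap bridges them.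
    no-break : ∀ {t₁ t₂} → t₁ < t₂ → t₂ < 2 * n →
      Anchored′ t₁ → ¬ Anchored′ (suc t₁) → ¬ Anchored′ t₂ → Anchored′ (suc t₂) → ⊥
    no-break {t₁} {t₂} t₁<t₂ t₂<2n anchored₁ ¬anchored₁₊₁ ¬anchored₂ anchored₂₊₁ =
      ¬anchored₁₊₁ (anchored-across-gap (t₁ + a) anchored₁ z′₁≤δ (gap-empty (n<1+n t₁) (s≤s t₁<t₂))
                                        beyond)
      where
      heavy₁ : δ ≤ z′ t₁
      heavy₁ = ≮⇒≥ (λ light → ¬anchored₁₊₁ (anchored-up (t₁ + a) anchored₁ light))
      heavy₂ : δ ≤ z′ (suc t₂)
      heavy₂ = ≮⇒≥ (λ light → ¬anchored₂ (anchored-down (t₂ + a) anchored₂₊₁ light))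
      t₂₊₁<2n : suc t₂ < 2 * n
      t₂₊₁<2n with m≤n⇒m<n∨m≡n t₂<2n
      ... | inj₁ t₂₊₁<2n = t₂₊₁<2n
      ... | inj₂ refl    = ⊥-elim (<⇒≱ (subst (_< δ) (sym (z-periodic a)) zₐ<δ) heavy₂)
      gap-empty : ∀ {c} → t₁ < c → c < suc t₂ → z′ c ≡ 0
      gap-empty t₁<c c<t₂₊₁ =
        x+w+y≤2d⇒w≡0 (≤-trans (terms≤sumBelow₃ z′ t₁<c c<t₂₊₁ t₂₊₁<2n) Σz′≤2δ) heavy₁ heavy₂
      z′₁≤δ : z′ t₁ ≤ δ
      z′₁≤δ = x+y≤2d⇒x≤d (≤-trans (terms≤sumBelow₂ z′ (<-trans t₁<t₂ (n<1+n t₂)) t₂₊₁<2n) Σz′≤2δ)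
                         heavy₂
      beyond : z′ (suc (suc t₁)) ≡ 0 ⊎ Anchored′ (suc (suc t₁))
      beyond with m≤n⇒m<n∨m≡n t₁<t₂
      ... | inj₁ t₁₊₁<t₂ = inj₁ (gap-empty (≤-trans (n<1+n t₁) (n≤1+n _)) (s≤s t₁₊₁<t₂))
      ... | inj₂ refl    = inj₂ anchored₂₊₁

    anchored-within-period : ∀ t → t < 2 * n → Anchored′ t
    anchored-within-period t t<2n = Anchored-stable r (t + a) λ ¬anchoredₜ →
      ¬¬-descent Anchored′ anchoredₐ ¬anchoredₜ z≤n λ (t₁ , _ , t₁<t , anchored₁ , ¬anchored₁₊₁) →
      ¬¬-descent (¬_ ∘ Anchored′) ¬anchoredₜ (λ ¬anchored₂ₙ → ¬anchored₂ₙ (Anchored-periodic⁻¹ r a anchoredₐ))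
        (<⇒≤ t<2n) λ (t₂ , t≤t₂ , t₂<2n , ¬anchored₂ , ¬¬anchored₂₊₁) →
      no-break (<-≤-trans t₁<t t≤t₂) t₂<2n anchored₁ ¬anchored₁₊₁ ¬anchored₂
               (Anchored-stable r (suc t₂ + a) ¬¬anchored₂₊₁)

    anchored-everywhere : ∀ s → s < 2 * n → Anchored r s
    anchored-everywhere s s<2n with a ≤? s
    ... | yes a≤s = subst (Anchored r) (m∸n+n≡m a≤s)
                      (anchored-within-period (s ∸ a) (≤-<-trans (m∸n≤m s a) s<2n))
    ... | no  a≰s = Anchored-periodic r s (subst (Anchored r) (m∸n+n≡m a≤2n+s)
                      (anchored-within-period (2 * n + s ∸ a) wrapped<2n))
      where
      a≤2n+s : a ≤ 2 * n + s
      a≤2n+s = ≤-trans (<⇒≤ a<2n) (m≤m+n _ s)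
      wrapped<2n : 2 * n + s ∸ a < 2 * n
      wrapped<2n = subst (2 * n + s ∸ a <_) (m+n∸n≡m (2 * n) a)
                     (∸-monoˡ-< (+-monoʳ-< (2 * n) (≰⇒> a≰s)) a≤2n+s)

    reaches : ∀ {x} → Survives x → NonIsolated x → ¬ ¬ (r ⇝ x)
    reaches {x} sx nx with combine-surjective {m} {n} x
    ... | v , i , refl with position-of i (col v)
    ...   | s , s<2n , layerₛ , isXₛ =
      subst₂ (AnchoredLayer r) layerₛ isXₛ (anchored-everywhere s s<2n) v refl sx nx

  survivors-connected : ∣ S ∣ ≤ 2 * δ → 2 * δ < n * κ → ∀ {x y} → Survives x → Survives y →
    NonIsolated x → NonIsolated y → ¬ ¬ (x ⇝ y)
  survivors-connected S≤2δ 2δ<nκ sx sy nx ny with light-copy S≤2δ 2δ<nκ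
  ... | a , a<2n , light with light-copy-anchor a light
  ...   | r , anchoredₐ = ¬¬-trans (¬¬-map (Reach-sym (G̃-sym sym-A)) (reaches sx nx)) (reaches sy ny)
    where open Sweep {r} {a} a<2n (light⇒z<δ a light) (≤-trans (≤-reflexive ∑z≡∣S∣) S≤2δ) anchoredₐ

  NonIsolated? : ∀ x → Dec (NonIsolated x)
  NonIsolated? x = any? (λ y → (G̃ x y Bool.≟ true) ×-dec (lookup S y Bool.≟ false))

  isolated⇒Nbhd⊆S : ∀ {x} → ¬ NonIsolated x → ∀ y → G̃ x y ≡ true → lookup S y ≡ true
  isolated⇒Nbhd⊆S {x} isolated y xy with lookup S y in S[y]
  ... | true  = refl
  ... | false = ⊥-elim (isolated (y , xy , S[y]))

  minimum-cut-is-Nbhd : (∀ v → A v v ≡ false) → 2 ≤ n → ∣ S ∣ ≤ 2 * δ → 2 * δ < n * κ →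
    ∀ {k} → (∀ T → IsCut G̃ T → k ≤ ∣ T ∣) → IsCut G̃ S → ∣ S ∣ ≡ k →
    ∃ λ v → S ≡ Nbhd G̃ v × (∀ w → deg G̃ v ≤ deg G̃ w)
  minimum-cut-is-Nbhd irrefl-A 2≤n S≤2δ 2δ<nκ k≤cut (x , y , sx , sy , ¬x⇝y) ∣S∣≡k =
    by-isolation (NonIsolated? x) (NonIsolated? y)
    where
    Nbhd-of : ∀ {x} → ¬ NonIsolated x → ∃ λ v → S ≡ Nbhd G̃ v × (∀ w → deg G̃ v ≤ deg G̃ w)
    Nbhd-of isolated = min-cut⊇Nbhd⇒≡Nbhd (Nbhd-G̃-isCut irrefl-A 2≤n) k≤cut ∣S∣≡k (isolated⇒Nbhd⊆S isolated)
    by-isolation : Dec (NonIsolated x) → Dec (NonIsolated y) →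
      ∃ λ v → S ≡ Nbhd G̃ v × (∀ w → deg G̃ v ≤ deg G̃ w)
    by-isolation (no isolated) _             = Nbhd-of isolated
    by-isolation (yes _)       (no isolated) = Nbhd-of isolated
    by-isolation (yes nx)      (yes ny)      = ⊥-elim (survivors-connected S≤2δ 2δ<nκ sx sy nx ny ¬x⇝y)

lemma2p2 : ∀ {m} (A : Adj m) (col : Fin m → Bool) (n : ℕ) → 3 ≤ n →
    IsSimple A → Connected A → IsBipartition A col →
    ∀ (δ κ : ℕ) → IsMinDegree A δ → IsConnectivity A κ →
    suc δ ≤ ∣ XSet col ∣ → suc δ ≤ ∣ YSet col ∣ →
    2 * δ < n * κ →
    SuperKappa (tildeAdj A col n)
lemma2p2 {m} A col (suc n′) 3≤n (sym-A , irrefl-A) _ bipartite δ κ ((w₀ , deg-w₀) , δ≤deg) κ-spec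
  X-large Y-large 2δ<nκ k S k-spec S-cut ∣S∣≡k with non-neighbour-across {A = A} col X-large Y-large w₀ deg-w₀
... | u , u≢w₀ , w₀≁u = minimum-cut-is-Nbhd irrefl-A 2≤n S≤2δ 2δ<nκ k≤cut S-cut ∣S∣≡k
  where
  open Lift A col n′
  2≤n : 2 ≤ n
  2≤n = ≤-trans (n≤1+n 2) 3≤n
  κ≤cut : ∀ T → IsCut A T → κ ≤ ∣ T ∣
  κ≤cut = connectivity≤cut κ-spec (nonadjacent⇒¬Complete u≢w₀ w₀≁u)
  κ≤δ : κ ≤ δ
  κ≤δ = subst (κ ≤_) deg-w₀ (κ≤cut _ (Nbhd-isCut (irrefl-A w₀) w₀≁u u≢w₀))
  1≤κ : 1 ≤ κ
  1≤κ = n≢0⇒n>0 λ κ≡0 → <⇒≱ 2δ<nκ (≤-trans (≤-reflexive (trans (cong (n *_) κ≡0) (*-zeroʳ n))) z≤n)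
  k≤cut : ∀ T → IsCut G̃ T → k ≤ ∣ T ∣
  k≤cut = connectivity≤cut k-spec (G̃-¬Complete irrefl-A 2≤n (combine w₀ Fin.zero))
  S≤2δ : ∣ S ∣ ≤ 2 * δ
  S≤2δ = subst₂ (λ s d → s ≤ 2 * d) (sym ∣S∣≡k) deg-w₀ (cuts≤2deg irrefl-A 2≤n k≤cut w₀)
  open Survivors A col n′ sym-A bipartite δ κ 1≤κ κ≤δ δ≤deg X-large Y-large κ≤cut S
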